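{- Let $m\ge2$, let $G$ be a finite Abelian group and $S=(s_1,\dots,s_n)\in G^n$ with $G=[-m+1,m]^*\diamond_2 S$. Let $s=\lfloor\log_2 m\rfloor$. Then $$\log_2(m_2(G)+1)\le \frac{2}{s+1}\log_2 n+\lfloor\log_2 s\rfloor+\frac{s-2^{\lfloor\log_2 s\rfloor+1}}{s+1}+5.$$
   Context: $[a,b]^*=\{a,\dots,b\}\setminus\{0\}$. For a finite Abelian group $G$, finite $M\subseteq\mathbb{Z}\setminus\{0\}$, $t\ge1$ and $S=(s_1,\dots,s_n)\in G^n$: $G\ge M\diamond_t S$ means the elements $\sum_i e_is_i$, for $\mathbf{e}\in(M\cup\{0\})^n$ with $1\le\mathrm{wt}(\mathbf{e})\le t$ (Hamming weight), are nonzero and pairwise distinct for distinct $\mathbf{e}$; $G\le M\diamond_t S$ means every $g\in G$ equals $\sum_ie_is_i$ for some $\mathbf{e}\in(M\cup\{0\})^n$ with $\mathrm{wt}(\mathbf{e})\le t$; $G=M\diamond_t S$ means both. $m_2(G)$ is the number of elements of $G$ of order exactly $2$. -}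

module Defs where

open import Level using (Level)
open import Algebra.Bundles using (AbelianGroup)
open import Data.Nat as ℕ using (ℕ; zero; suc)
open import Data.Integer as ℤ using (ℤ; +_; -[1+_]; 0ℤ)
open import Data.Fin using (Fin)
import Data.Fin as Fin
open import Data.Product using (Σ; ∃; _×_; _,_)
open import Data.Sum using (_⊎_)
open import Relation.Nullary using (¬_; Dec; does)
open import Relation.Binary.PropositionalEquality using (_≡_)
open import Data.Bool using (Bool; true; false; if_then_else_)

countFin : (n : ℕ) → (Fin n → Bool) → ℕ
countFin zero    p = 0
countFin (suc n) p = (if p Fin.zero then 1 else 0) ℕ.+ countFin n (λ i → p (Fin.suc i))

wt : {n : ℕ} → (Fin n → ℤ) → ℕ
wt {n} e = countFin n (λ i → Data.Bool.not (does (e i ℤ.≟ 0ℤ)))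

Interval* : ℤ → ℤ → ℤ → Set
Interval* a b z = (a ℤ.≤ z) × (z ℤ.≤ b) × ¬ (z ≡ 0ℤ)

module _ {c ℓ : Level} (G : AbelianGroup c ℓ) where
  open AbelianGroup G

  natMul : ℕ → Carrier → Carrier
  natMul zero    x = ε
  natMul (suc n) x = x ∙ natMul n x

  intMul : ℤ → Carrier → Carrier
  intMul (+ n)      x = natMul n x
  intMul -[1+ n ]   x = (natMul (suc n) x) ⁻¹

  gsum : (n : ℕ) → (Fin n → Carrier) → Carrier
  gsum zero    f = ε
  gsum (suc n) f = f Fin.zero ∙ gsum n (λ i → f (Fin.suc i))

  lin : {n : ℕ} → (Fin n → ℤ) → (Fin n → Carrier) → Carrier
  lin {n} e S = gsum n (λ i → intMul (e i) (S i))

  Coeffs : (M : ℤ → Set) → {n : ℕ} → (Fin n → ℤ) → Set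
  Coeffs M e = ∀ i → (e i ≡ 0ℤ) ⊎ M (e i)

  Packing : (M : ℤ → Set) → (t : ℕ) → {n : ℕ} → (Fin n → Carrier) → Set _
  Packing M t {n} S =
    (∀ (e : Fin n → ℤ) → Coeffs M e → 1 ℕ.≤ wt e → wt e ℕ.≤ t →
       ¬ (lin e S ≈ ε))
    × (∀ (e e′ : Fin n → ℤ) → Coeffs M e → 1 ℕ.≤ wt e → wt e ℕ.≤ t →
       Coeffs M e′ → 1 ℕ.≤ wt e′ → wt e′ ℕ.≤ t →
       lin e S ≈ lin e′ S → ∀ i → e i ≡ e′ i)

  Covering : (M : ℤ → Set) → (t : ℕ) → {n : ℕ} → (Fin n → Carrier) → Set _
  Covering M t {n} S =
    ∀ (g : Carrier) → Σ (Fin n → ℤ) λ e → Coeffs M e × wt e ℕ.≤ t × (lin e S ≈ g)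

  Perfect : (M : ℤ → Set) → (t : ℕ) → {n : ℕ} → (Fin n → Carrier) → Set _
  Perfect M t S = Packing M t S × Covering M t S

  record FiniteEnum : Set (c Level.⊔ ℓ) where
    field
      size      : ℕ
      enum      : Fin size → Carrier
      enum-inj  : ∀ i j → enum i ≈ enum j → i ≡ j
      enum-surj : ∀ x → ∃ λ i → enum i ≈ x

  order2? : (∀ x y → Dec (x ≈ y)) → Carrier → Bool
  order2? _≟_ x = Data.Bool._∧_ (Data.Bool.not (does (x ≟ ε))) (does ((x ∙ x) ≟ ε))

  m₂ : FiniteEnum → (∀ x y → Dec (x ≈ y)) → ℕ
  m₂ F _≟_ = countFin (FiniteEnum.size F) (λ i → order2? _≟_ (FiniteEnum.enum F i))

{-# OPTIONS --safe #-}
module Submission where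

open import Defs
open import Level using (Level)
open import Algebra.Bundles using (AbelianGroup)
open import Data.Nat using (ℕ; suc; _+_; _*_; _^_; _≤_)
open import Data.Nat.Logarithm using (⌊log₂_⌋)
open import Data.Integer using (+_; -_)
open import Data.Fin using (Fin)
open import Relation.Nullary using (Dec)

open import Data.Bool using (Bool; true; false; if_then_else_; not; T)
open import Data.Fin using (zero; suc; toℕ; combine; remQuot)
import Data.Fin.Properties as Finₚ
open import Data.Integer as ℤ using (ℤ; -[1+_]; 0ℤ; +≤+; -≤+; -≤-)
import Data.Integer.Properties as ℤₚ
open import Data.List using (List; []; _∷_; length)
import Data.List.Properties as Listₚ
open import Data.Nat as ℕ using (zero; _<_; z≤n; s≤s; ⌊_/2⌋; ⌈_/2⌉)
open import Data.Nat.DivMod using (_mod_; _/_; _%_; m≡m%n+[m/n]*n; m/n*n≤m)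
open import Data.Nat.Induction using (<-wellFounded)
open import Data.Nat.Logarithm.Core using (⌊log2⌋)
import Data.Nat.Properties as ℕₚ
open import Data.Nat.Tactic.RingSolver using (solve-∀)
open import Data.Product using (_×_; _,_; proj₁; proj₂; uncurry)
open import Data.Sum using (_⊎_; inj₁; inj₂)
open import Function using (_∘_; Injective)
open import Function.Bundles using (Injection)
open import Function.Properties.Inverse using (Inverse⇒Injection)
open import Induction.WellFounded using (Acc; acc)
open import Relation.Binary.PropositionalEquality
  using (_≡_; _≢_; refl; sym; trans; cong; cong₂; subst; module ≡-Reasoning)
open import Relation.Nullary using (¬_; yes; no; does)
open import Relation.Nullary.Decidable using (isYes; toWitness; fromWitness)
open import Relation.Nullary.Negation using (contradiction)

-- Call an element h of G halvable if every coefficient e of its representation h = ∑ eᵢ sᵢ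
-- still satisfies 2e ∈ [1 - m, m]. Then 2h = ∑ 2eᵢ sᵢ is again a representation, so by
-- uniqueness doubling is injective on halvable elements; hence the translates t + h, with t
-- of order at most 2 and h halvable, are pairwise distinct, and (m₂(G) + 1)·K ≤ |G| where K
-- counts the halvable elements. Conversely, list ℤ ∖ {0} as 1, -1, 2, -2, …; replacing each
-- nonzero coefficient, at position 3q + r, by the q-th entry c of that list (2c ∈ [1 - m, m]
-- because 3q + r + 2 ≤ 2m) gives the representation of a halvable element, and g is
-- recovered from it together with the at most two digits r. So |G| ≤ 16 K, whence
-- m₂(G) < 16 and the stated bound is arithmetic.

select : ∀ n (p : Fin n → Bool) → Fin (countFin n p) → Fin n
select (suc n) p k with p zero
select (suc n) p zero    | true  = zero
select (suc n) p (suc k) | true  = suc (select n (p ∘ suc) k)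
select (suc n) p k       | false = suc (select n (p ∘ suc) k)

select-satisfies : ∀ n (p : Fin n → Bool) k → T (p (select n p k))
select-satisfies (suc n) p k with p zero in p0
select-satisfies (suc n) p zero    | true  = subst T (sym p0) _
select-satisfies (suc n) p (suc k) | true  = select-satisfies n (p ∘ suc) k
select-satisfies (suc n) p k       | false = select-satisfies n (p ∘ suc) k

select-injective : ∀ n (p : Fin n → Bool) {k l} → select n p k ≡ select n p l → k ≡ l
select-injective (suc n) p {k} {l} eq with p zero
select-injective (suc n) p {zero}  {zero}  eq | true  = refl
select-injective (suc n) p {suc k} {suc l} eq | true  =
  cong suc (select-injective n (p ∘ suc) (Finₚ.suc-injective eq))
select-injective (suc n) p {k}     {l}     eq | false =
  select-injective n (p ∘ suc) (Finₚ.suc-injective eq)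

rank : ∀ n (p : Fin n → Bool) (i : Fin n) → T (p i) → Fin (countFin n p)
rank (suc n) p zero    t with p zero
... | true  = zero
rank (suc n) p (suc i) t with p zero
... | true  = suc (rank n (p ∘ suc) i t)
... | false = rank n (p ∘ suc) i t

select-rank : ∀ n (p : Fin n → Bool) i (t : T (p i)) → select n p (rank n p i t) ≡ i
select-rank (suc n) p zero    t with p zero
... | true  = refl
select-rank (suc n) p (suc i) t with p zero
... | true  = cong suc (select-rank n (p ∘ suc) i t)
... | false = cong suc (select-rank n (p ∘ suc) i t)

rank-injective : ∀ n (p : Fin n → Bool) {i j} (ti : T (p i)) (tj : T (p j)) →
                 rank n p i ti ≡ rank n p j tj → i ≡ j
rank-injective n p {i} {j} ti tj eq = begin
  i                           ≡⟨ select-rank n p i ti ⟨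
  select n p (rank n p i ti)  ≡⟨ cong (select n p) eq ⟩
  select n p (rank n p j tj)  ≡⟨ select-rank n p j tj ⟩
  j                           ∎
  where open ≡-Reasoning

countFin-cong : ∀ n {p q : Fin n → Bool} → (∀ i → p i ≡ q i) → countFin n p ≡ countFin n q
countFin-cong zero    p≗q = refl
countFin-cong (suc n) p≗q =
  cong₂ (λ b c → (if b then 1 else 0) + c) (p≗q zero) (countFin-cong n (p≗q ∘ suc))

countFin≡0⇒false : ∀ n (p : Fin n → Bool) → countFin n p ≡ 0 → ∀ i → p i ≡ false
countFin≡0⇒false (suc n) p eq i with p zero in p0
countFin≡0⇒false (suc n) p eq zero    | false = p0
countFin≡0⇒false (suc n) p eq (suc i) | false = countFin≡0⇒false n (p ∘ suc) eq i

wt≡0⇒zero : ∀ {n} (e : Fin n → ℤ) → wt e ≡ 0 → ∀ i → e i ≡ 0ℤ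
wt≡0⇒zero {n} e eq i with e i ℤ.≟ 0ℤ | countFin≡0⇒false n _ eq i
... | yes ei≡0 | _ = ei≡0

wt-∘ : ∀ {n} (f : ℤ → ℤ) → f 0ℤ ≡ 0ℤ → (∀ z → f z ≡ 0ℤ → z ≡ 0ℤ) →
       (e : Fin n → ℤ) → wt (f ∘ e) ≡ wt e
wt-∘ {n} f f0≡0 f≡0⇒≡0 e = countFin-cong n same-support
  where
  same-support : ∀ i → not (does (f (e i) ℤ.≟ 0ℤ)) ≡ not (does (e i ℤ.≟ 0ℤ))
  same-support i with f (e i) ℤ.≟ 0ℤ | e i ℤ.≟ 0ℤ
  ... | yes _    | yes _    = refl
  ... | no  _    | no  _    = refl
  ... | yes fe≡0 | no  ei≢0 = contradiction (f≡0⇒≡0 (e i) fe≡0) ei≢0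
  ... | no  fe≢0 | yes ei≡0 = contradiction (trans (cong f ei≡0) f0≡0) fe≢0

injective⇒*≤ : ∀ {a b c} (f : Fin a → Fin b → Fin c) →
               (∀ {i j i′ j′} → f i j ≡ f i′ j′ → i ≡ i′ × j ≡ j′) → a * b ≤ c
injective⇒*≤ {a} {b} f f-injective = Finₚ.injective⇒≤ {f = uncurry f ∘ remQuot {a} b} injective
  where
  injective : Injective _≡_ _≡_ (uncurry f ∘ remQuot {a} b)
  injective eq with f-injective eq
  ... | i≡i′ , j≡j′ = Injection.injective (Inverse⇒Injection (Finₚ.*↔× {a} {b})) (cong₂ _,_ i≡i′ j≡j′)

injective⇒≤* : ∀ {a b c} (f : Fin a → Fin b × Fin c) → Injective _≡_ _≡_ f → a ≤ b * c
injective⇒≤* f f-injective = Finₚ.injective⇒≤ {f = uncurry combine ∘ f}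
  (f-injective ∘ uncurry (cong₂ _,_) ∘ Finₚ.combine-injective _ _ _ _)

module _ {c ℓ : Level} (G : AbelianGroup c ℓ) where
  open AbelianGroup G hiding (refl) renaming (sym to ≈-sym; trans to ≈-trans)
  open import Algebra.Definitions.RawMonoid rawMonoid using (sum) renaming (_×_ to _×ₘ_)
  open import Algebra.Properties.Monoid.Mult monoid using (×-homo-+)
  open import Algebra.Properties.CommutativeMonoid.Sum commutativeMonoid
    using (∑-distrib-+; sum-cong-≋; sum-replicate-zero)
  open import Algebra.Properties.AbelianGroup G using (⁻¹-∙-comm)
  open import Algebra.Properties.CommutativeSemigroup commutativeSemigroup using (interchange)
  open import Relation.Binary.Reasoning.Setoid setoid

  natMul≡× : ∀ k x → natMul G k x ≡ k ×ₘ x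
  natMul≡× zero    x = refl
  natMul≡× (suc k) x = cong (x ∙_) (natMul≡× k x)

  gsum≡sum : ∀ n (f : Fin n → Carrier) → gsum G n f ≡ sum f
  gsum≡sum zero    f = refl
  gsum≡sum (suc n) f = cong (f zero ∙_) (gsum≡sum n (f ∘ suc))

  natMul-+ : ∀ a b x → natMul G (a + b) x ≈ natMul G a x ∙ natMul G b x
  natMul-+ a b x = begin
    natMul G (a + b) x           ≡⟨ natMul≡× (a + b) x ⟩
    (a + b) ×ₘ x                 ≈⟨ ×-homo-+ x a b ⟩
    a ×ₘ x ∙ b ×ₘ x              ≡⟨ cong₂ _∙_ (natMul≡× a x) (natMul≡× b x) ⟨
    natMul G a x ∙ natMul G b x  ∎

  intMul-double : ∀ z x → intMul G (z ℤ.+ z) x ≈ intMul G z x ∙ intMul G z x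
  intMul-double (+ k)    x = natMul-+ k k x
  intMul-double -[1+ k ] x = begin
    natMul G (suc (suc (k + k))) x ⁻¹              ≡⟨ cong (λ j → natMul G (suc j) x ⁻¹) (ℕₚ.+-suc k k) ⟨
    natMul G (suc k + suc k) x ⁻¹                  ≈⟨ ⁻¹-cong (natMul-+ (suc k) (suc k) x) ⟩
    (natMul G (suc k) x ∙ natMul G (suc k) x) ⁻¹   ≈⟨ ⁻¹-∙-comm _ _ ⟨
    natMul G (suc k) x ⁻¹ ∙ natMul G (suc k) x ⁻¹  ∎

  lin≡sum : ∀ {n} (e : Fin n → ℤ) S → lin G e S ≡ sum (λ i → intMul G (e i) (S i))
  lin≡sum {n} e S = gsum≡sum n _

  lin-cong : ∀ {n} {e e′ : Fin n → ℤ} (S : Fin n → Carrier) → (∀ i → e i ≡ e′ i) →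
             lin G e S ≈ lin G e′ S
  lin-cong {e = e} {e′} S e≗e′ = begin
    lin G e S                          ≡⟨ lin≡sum e S ⟩
    sum (λ i → intMul G (e i) (S i))   ≈⟨ sum-cong-≋ (λ i → reflexive (cong (λ z → intMul G z (S i)) (e≗e′ i))) ⟩
    sum (λ i → intMul G (e′ i) (S i))  ≡⟨ lin≡sum e′ S ⟨
    lin G e′ S                         ∎

  lin-zero : ∀ {n} {e : Fin n → ℤ} (S : Fin n → Carrier) → (∀ i → e i ≡ 0ℤ) → lin G e S ≈ ε
  lin-zero {n} {e} S e≗0 = begin
    lin G e S           ≈⟨ lin-cong S e≗0 ⟩
    lin G (λ _ → 0ℤ) S  ≡⟨ lin≡sum (λ _ → 0ℤ) S ⟩
    sum {n} (λ _ → ε)   ≈⟨ sum-replicate-zero n ⟩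
    ε                   ∎

  lin-double : ∀ {n} (e : Fin n → ℤ) (S : Fin n → Carrier) →
               lin G (λ i → e i ℤ.+ e i) S ≈ lin G e S ∙ lin G e S
  lin-double e S = begin
    lin G (λ i → e i ℤ.+ e i) S                              ≡⟨ lin≡sum (λ i → e i ℤ.+ e i) S ⟩
    sum (λ i → intMul G (e i ℤ.+ e i) (S i))                 ≈⟨ sum-cong-≋ (λ i → intMul-double (e i) (S i)) ⟩
    sum (λ i → intMul G (e i) (S i) ∙ intMul G (e i) (S i))  ≈⟨ ∑-distrib-+ es es ⟩
    sum es ∙ sum es                                          ≡⟨ cong₂ _∙_ (lin≡sum e S) (lin≡sum e S) ⟨
    lin G e S ∙ lin G e S                                    ∎
    where es = λ i → intMul G (e i) (S i)

  square-∙-involution : ∀ {t} h → t ∙ t ≈ ε → (t ∙ h) ∙ (t ∙ h) ≈ h ∙ h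
  square-∙-involution {t} h t²≈ε = begin
    (t ∙ h) ∙ (t ∙ h)  ≈⟨ interchange t h t h ⟩
    (t ∙ t) ∙ (h ∙ h)  ≈⟨ ∙-congʳ t²≈ε ⟩
    ε ∙ (h ∙ h)        ≈⟨ identityˡ _ ⟩
    h ∙ h              ∎

  packing-unique : ∀ {M : ℤ → Set} {t n} {S : Fin n → Carrier} → Packing G M t S →
                   ∀ {e e′} → Coeffs G M e → wt e ≤ t → Coeffs G M e′ → wt e′ ≤ t →
                   lin G e S ≈ lin G e′ S → ∀ i → e i ≡ e′ i
  packing-unique {S = S} (nonzero , distinct) {e} {e′} e-ok e≤t e′-ok e′≤t eq
    with wt e ℕ.≟ 0 | wt e′ ℕ.≟ 0
  ... | yes e≡0 | yes e′≡0 = λ i → trans (wt≡0⇒zero e e≡0 i) (sym (wt≡0⇒zero e′ e′≡0 i))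
  ... | yes e≡0 | no  e′≢0 =
    contradiction (≈-trans (≈-sym eq) (lin-zero S (wt≡0⇒zero e e≡0))) (nonzero e′ e′-ok (ℕₚ.n≢0⇒n>0 e′≢0) e′≤t)
  ... | no  e≢0 | yes e′≡0 =
    contradiction (≈-trans eq (lin-zero S (wt≡0⇒zero e′ e′≡0))) (nonzero e e-ok (ℕₚ.n≢0⇒n>0 e≢0) e≤t)
  ... | no  e≢0 | no  e′≢0 =
    distinct e e′ e-ok (ℕₚ.n≢0⇒n>0 e≢0) e≤t e′-ok (ℕₚ.n≢0⇒n>0 e′≢0) e′≤t eq

-- the least m with z ∈ [1 - m, m]
width : ℤ → ℕ
width (+ n)    = n
width -[1+ n ] = suc (suc n)

inRange⇒width≤ : ∀ k z → z ≡ 0ℤ ⊎ Interval* -[1+ k ] (+ suc (suc k)) z → width z ≤ suc (suc k)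
inRange⇒width≤ k _        (inj₁ refl)              = z≤n
inRange⇒width≤ k (+ n)    (inj₂ (_ , +≤+ n≤m , _)) = n≤m
inRange⇒width≤ k -[1+ n ] (inj₂ (-≤- n≤k , _ , _)) = s≤s (s≤s n≤k)

width≤⇒inRange : ∀ k z → width z ≤ suc (suc k) → z ≡ 0ℤ ⊎ Interval* -[1+ k ] (+ suc (suc k)) z
width≤⇒inRange k (+ zero)  _               = inj₁ refl
width≤⇒inRange k (+ suc n) n≤m             = inj₂ (-≤+ , +≤+ n≤m , λ ())
width≤⇒inRange k -[1+ n ]  (s≤s (s≤s n≤k)) = inj₂ (-≤- n≤k , -≤+ , λ ())

width≤width-double : ∀ z → width z ≤ width (z ℤ.+ z)
width≤width-double (+ n)    = ℕₚ.m≤m+n n n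
width≤width-double -[1+ n ] = s≤s (s≤s (ℕₚ.m≤n⇒m≤1+n (ℕₚ.m≤m+n n n)))

double-injective : ∀ z z′ → z ℤ.+ z ≡ z′ ℤ.+ z′ → z ≡ z′
double-injective z z′ eq = ℤₚ.*-cancelˡ-≡ (+ 2) z z′ (begin
  + 2 ℤ.* z   ≡⟨ 2*≡double z ⟩
  z ℤ.+ z     ≡⟨ eq ⟩
  z′ ℤ.+ z′   ≡⟨ 2*≡double z′ ⟨
  + 2 ℤ.* z′  ∎)
  where
  open ≡-Reasoning
  2*≡double : ∀ z → + 2 ℤ.* z ≡ z ℤ.+ z
  2*≡double z = trans (ℤₚ.*-distribʳ-+ z (+ 1) (+ 1)) (cong₂ ℤ._+_ (ℤₚ.*-identityˡ z) (ℤₚ.*-identityˡ z))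

doubled : ∀ {n} → (Fin n → ℤ) → Fin n → ℤ
doubled e i = e i ℤ.+ e i

wt-doubled : ∀ {n} (e : Fin n → ℤ) → wt (doubled e) ≡ wt e
wt-doubled = wt-∘ (λ z → z ℤ.+ z) refl (λ z 2z≡0 → double-injective z 0ℤ 2z≡0)

-- ℤ ∖ {0} listed as 1, -1, 2, -2, …; position inverts nonzeroAt (its value at 0 is junk)
position : ℤ → ℕ
position (+ zero)  = 0
position (+ suc n) = n + n
position -[1+ n ]  = suc (n + n)

awayFromZero : ℤ → ℤ
awayFromZero (+ n)    = + suc n
awayFromZero -[1+ n ] = -[1+ suc n ]

nonzeroAt : ℕ → ℤ
nonzeroAt zero          = + 1
nonzeroAt (suc zero)    = -[1+ 0 ]
nonzeroAt (suc (suc q)) = awayFromZero (nonzeroAt q)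

nonzeroAt≢0 : ∀ q → nonzeroAt q ≢ 0ℤ
nonzeroAt≢0 zero          ()
nonzeroAt≢0 (suc zero)    ()
nonzeroAt≢0 (suc (suc q)) with nonzeroAt q
... | + _      = λ ()
... | -[1+ _ ] = λ ()

position-awayFromZero : ∀ z → z ≢ 0ℤ → position (awayFromZero z) ≡ suc (suc (position z))
position-awayFromZero (+ zero)  z≢0 = contradiction refl z≢0
position-awayFromZero (+ suc n) _   = cong suc (ℕₚ.+-suc n n)
position-awayFromZero -[1+ n ]  _   = cong (λ x → suc (suc x)) (ℕₚ.+-suc n n)

position-nonzeroAt : ∀ q → position (nonzeroAt q) ≡ q
position-nonzeroAt zero          = refl
position-nonzeroAt (suc zero)    = refl
position-nonzeroAt (suc (suc q)) =
  trans (position-awayFromZero (nonzeroAt q) (nonzeroAt≢0 q)) (cong (λ x → suc (suc x)) (position-nonzeroAt q))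

nonzeroAt-even : ∀ n → nonzeroAt (n + n) ≡ + suc n
nonzeroAt-even zero    = refl
nonzeroAt-even (suc n) rewrite ℕₚ.+-suc n n = cong awayFromZero (nonzeroAt-even n)

nonzeroAt-odd : ∀ n → nonzeroAt (suc (n + n)) ≡ -[1+ n ]
nonzeroAt-odd zero    = refl
nonzeroAt-odd (suc n) rewrite ℕₚ.+-suc n n = cong awayFromZero (nonzeroAt-odd n)

nonzeroAt-position : ∀ z → z ≢ 0ℤ → nonzeroAt (position z) ≡ z
nonzeroAt-position (+ zero)  z≢0 = contradiction refl z≢0
nonzeroAt-position (+ suc n) _   = nonzeroAt-even n
nonzeroAt-position -[1+ n ]  _   = nonzeroAt-odd n

width-double : ∀ z → z ≢ 0ℤ → width (z ℤ.+ z) ≡ suc (suc (position z))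
width-double (+ zero)  z≢0 = contradiction refl z≢0
width-double (+ suc n) _   = cong suc (ℕₚ.+-suc n n)
width-double -[1+ n ]  _   = refl

position≤ : ∀ k z → width z ≤ suc (suc k) → position z ≤ suc (suc (k + k))
position≤ k (+ zero)  _               = z≤n
position≤ k (+ suc n) (s≤s n≤1+k)     = subst (n + n ≤_) (ℕₚ.+-suc (suc k) k) (ℕₚ.+-mono-≤ n≤1+k n≤1+k)
position≤ k -[1+ n ]  (s≤s (s≤s n≤k)) = s≤s (ℕₚ.m≤n⇒m≤1+n (ℕₚ.+-mono-≤ n≤k n≤k))

*3≤2+[k+k]⇒≤ : ∀ q k → q * 3 ≤ suc (suc (k + k)) → q ≤ k
*3≤2+[k+k]⇒≤ zero    k       _                     = z≤n
*3≤2+[k+k]⇒≤ (suc q) zero    (s≤s (s≤s ()))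
*3≤2+[k+k]⇒≤ (suc q) (suc k) (s≤s (s≤s (s≤s 3q≤))) =
  s≤s (*3≤2+[k+k]⇒≤ q k (ℕₚ.m≤n⇒m≤1+n (subst (q * 3 ≤_) (ℕₚ.+-suc k k) 3q≤)))

encode : ℤ → Fin 3 × ℤ
encode (+ zero) = zero , 0ℤ
encode z        = position z mod 3 , nonzeroAt (position z / 3)

decode : Fin 3 × ℤ → ℤ
decode (r , c) = nonzeroAt (toℕ r + position c * 3)

decode-digits : ∀ p → decode (p mod 3 , nonzeroAt (p / 3)) ≡ nonzeroAt p
decode-digits p = cong nonzeroAt (begin
  toℕ (p mod 3) + position (nonzeroAt (p / 3)) * 3  ≡⟨ cong₂ (λ r q → r + q * 3) (Finₚ.toℕ-fromℕ< _) (position-nonzeroAt (p / 3)) ⟩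
  p % 3 + (p / 3) * 3                               ≡⟨ m≡m%n+[m/n]*n p 3 ⟨
  p                                                 ∎)
  where open ≡-Reasoning

decode-encode : ∀ z → z ≢ 0ℤ → decode (encode z) ≡ z
decode-encode (+ zero)     z≢0 = contradiction refl z≢0
decode-encode z@(+ suc _)  z≢0 = trans (decode-digits (position z)) (nonzeroAt-position z z≢0)
decode-encode z@(-[1+ _ ]) z≢0 = trans (decode-digits (position z)) (nonzeroAt-position z z≢0)

encode≡0⇒≡0 : ∀ z → proj₂ (encode z) ≡ 0ℤ → z ≡ 0ℤ
encode≡0⇒≡0 (+ zero)     _   = refl
encode≡0⇒≡0 z@(+ suc _)  c≡0 = contradiction c≡0 (nonzeroAt≢0 (position z / 3))
encode≡0⇒≡0 z@(-[1+ _ ]) c≡0 = contradiction c≡0 (nonzeroAt≢0 (position z / 3))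

encode-determined : ∀ {z z′} → proj₂ (encode z) ≡ proj₂ (encode z′) →
                    (proj₂ (encode z) ≢ 0ℤ → proj₁ (encode z) ≡ proj₁ (encode z′)) → z ≡ z′
encode-determined {z} {z′} c≡c′ d≡d′ with proj₂ (encode z) ℤ.≟ 0ℤ
... | yes c≡0 = trans (encode≡0⇒≡0 z c≡0) (sym (encode≡0⇒≡0 z′ (trans (sym c≡c′) c≡0)))
... | no  c≢0 = begin
  z                   ≡⟨ decode-encode z (c≢0 ∘ cong (proj₂ ∘ encode)) ⟨
  decode (encode z)   ≡⟨ cong decode (cong₂ _,_ (d≡d′ c≢0) c≡c′) ⟩
  decode (encode z′)  ≡⟨ decode-encode z′ (c≢0 ∘ trans c≡c′ ∘ cong (proj₂ ∘ encode)) ⟩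
  z′                  ∎
  where open ≡-Reasoning

nonzeroAt-third-halvable : ∀ k p → p ≤ suc (suc (k + k)) →
                 width (nonzeroAt (p / 3) ℤ.+ nonzeroAt (p / 3)) ≤ suc (suc k)
nonzeroAt-third-halvable k p p≤ = begin
  width (nonzeroAt (p / 3) ℤ.+ nonzeroAt (p / 3))  ≡⟨ width-double (nonzeroAt (p / 3)) (nonzeroAt≢0 (p / 3)) ⟩
  suc (suc (position (nonzeroAt (p / 3))))         ≡⟨ cong (λ x → suc (suc x)) (position-nonzeroAt (p / 3)) ⟩
  suc (suc (p / 3))                                ≤⟨ s≤s (s≤s (*3≤2+[k+k]⇒≤ (p / 3) k (ℕₚ.≤-trans (m/n*n≤m p 3) p≤))) ⟩
  suc (suc k)                                      ∎
  where open ℕₚ.≤-Reasoning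

encode-halvable : ∀ k z → width z ≤ suc (suc k) →
                  width (proj₂ (encode z) ℤ.+ proj₂ (encode z)) ≤ suc (suc k)
encode-halvable k (+ zero)     _   = z≤n
encode-halvable k z@(+ suc _)  z≤m = nonzeroAt-third-halvable k (position z) (position≤ k z z≤m)
encode-halvable k z@(-[1+ _ ]) z≤m = nonzeroAt-third-halvable k (position z) (position≤ k z z≤m)

onSupport : ∀ {n} {A : Set} → (Fin n → ℤ) → (Fin n → A) → List A
onSupport {zero}  c d = []
onSupport {suc n} c d with c zero ℤ.≟ 0ℤ
... | yes _ = onSupport (c ∘ suc) (d ∘ suc)
... | no  _ = d zero ∷ onSupport (c ∘ suc) (d ∘ suc)

length-onSupport : ∀ {n} {A : Set} (c : Fin n → ℤ) (d : Fin n → A) → length (onSupport c d) ≡ wt c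
length-onSupport {zero}  c d = refl
length-onSupport {suc n} c d with c zero ℤ.≟ 0ℤ
... | yes _ = length-onSupport (c ∘ suc) (d ∘ suc)
... | no  _ = cong suc (length-onSupport (c ∘ suc) (d ∘ suc))

onSupport-injective : ∀ {n} {A : Set} {c c′ : Fin n → ℤ} {d d′ : Fin n → A} → (∀ i → c i ≡ c′ i) →
                      onSupport c d ≡ onSupport c′ d′ → ∀ i → c i ≢ 0ℤ → d i ≡ d′ i
onSupport-injective {suc n} {c = c} {c′} c≗c′ eq i ci≢0 with c zero ℤ.≟ 0ℤ | c′ zero ℤ.≟ 0ℤ
onSupport-injective c≗c′ eq zero    ci≢0 | yes c0≡0 | _          = contradiction c0≡0 ci≢0
onSupport-injective c≗c′ eq (suc i) ci≢0 | yes _    | yes _      = onSupport-injective (c≗c′ ∘ suc) eq i ci≢0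
onSupport-injective c≗c′ eq i       ci≢0 | yes c0≡0 | no  c′0≢0  = contradiction (trans (sym (c≗c′ zero)) c0≡0) c′0≢0
onSupport-injective c≗c′ eq i       ci≢0 | no  c0≢0 | yes c′0≡0  = contradiction (trans (c≗c′ zero) c′0≡0) c0≢0
onSupport-injective c≗c′ eq zero    ci≢0 | no  _    | no  _      = Listₚ.∷-injectiveˡ eq
onSupport-injective c≗c′ eq (suc i) ci≢0 | no  _    | no  _      =
  onSupport-injective (c≗c′ ∘ suc) (Listₚ.∷-injectiveʳ eq) i ci≢0

firstTwo : ∀ {k} → List (Fin k) → Fin (suc k) × Fin (suc k)
firstTwo []          = zero  , zero
firstTwo (x ∷ [])    = suc x , zero
firstTwo (x ∷ y ∷ _) = suc x , suc y

firstTwo-injective : ∀ {k} {xs ys : List (Fin k)} → length xs ≤ 2 → length ys ≤ 2 →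
                     firstTwo xs ≡ firstTwo ys → xs ≡ ys
firstTwo-injective {xs = []}          {[]}          _ _ _  = refl
firstTwo-injective {xs = x ∷ []}      {y ∷ []}      _ _ eq = cong (_∷ []) (Finₚ.suc-injective (cong proj₁ eq))
firstTwo-injective {xs = x ∷ x′ ∷ []} {y ∷ y′ ∷ []} _ _ eq =
  cong₂ (λ a b → a ∷ b ∷ []) (Finₚ.suc-injective (cong proj₁ eq)) (Finₚ.suc-injective (cong proj₂ eq))
firstTwo-injective {xs = _ ∷ _ ∷ _ ∷ _} (s≤s (s≤s ())) _ _
firstTwo-injective {ys = _ ∷ _ ∷ _ ∷ _} _ (s≤s (s≤s ())) _

-- Perfect codes with coefficients in [1 - m, m], m = 2 + k

module PerfectCode {c ℓ : Level} (G : AbelianGroup c ℓ) (F : FiniteEnum G)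
    (_≟_ : ∀ x y → Dec (AbelianGroup._≈_ G x y))
    (k n : ℕ) (S : Fin n → AbelianGroup.Carrier G)
    (perfect : Perfect G (Interval* -[1+ k ] (+ suc (suc k))) 2 S) where

  open AbelianGroup G hiding (refl) renaming (sym to ≈-sym; trans to ≈-trans)
  open FiniteEnum F
  open import Algebra.Properties.Group group using (∙-cancelʳ)
  open import Relation.Binary.Reasoning.Setoid setoid

  Bounded : (Fin n → ℤ) → Set
  Bounded e = ∀ i → width (e i) ≤ suc (suc k)

  Halvable : (Fin n → ℤ) → Set
  Halvable e = Bounded (doubled e)

  halvable? : ∀ e → Dec (Halvable e)
  halvable? e = Finₚ.all? (λ i → width (doubled e i) ℕₚ.≤? suc (suc k))

  halvable⇒bounded : ∀ {e} → Halvable e → Bounded e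
  halvable⇒bounded {e} h i = ℕₚ.≤-trans (width≤width-double (e i)) (h i)

  unique : ∀ {e e′} → Bounded e → wt e ≤ 2 → Bounded e′ → wt e′ ≤ 2 →
           lin G e S ≈ lin G e′ S → ∀ i → e i ≡ e′ i
  unique e-ok e≤2 e′-ok e′≤2 =
    packing-unique G {M = Interval* -[1+ k ] (+ suc (suc k))} (proj₁ perfect)
      (width≤⇒inRange k _ ∘ e-ok) e≤2 (width≤⇒inRange k _ ∘ e′-ok) e′≤2

  rep : Carrier → Fin n → ℤ
  rep g = proj₁ (proj₂ perfect g)

  rep-bounded : ∀ g → Bounded (rep g)
  rep-bounded g i = inRange⇒width≤ k _ (proj₁ (proj₂ (proj₂ perfect g)) i)

  rep-wt : ∀ g → wt (rep g) ≤ 2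
  rep-wt g = proj₁ (proj₂ (proj₂ (proj₂ perfect g)))

  lin-rep : ∀ g → lin G (rep g) S ≈ g
  lin-rep g = proj₂ (proj₂ (proj₂ (proj₂ perfect g)))

  rep-unique : ∀ {e g} → Bounded e → wt e ≤ 2 → lin G e S ≈ g → ∀ i → rep g i ≡ e i
  rep-unique e-ok e≤2 eq = unique (rep-bounded _) (rep-wt _) e-ok e≤2 (≈-trans (lin-rep _) (≈-sym eq))

  index : Carrier → Fin size
  index g = proj₁ (enum-surj g)

  enum-index : ∀ g → enum (index g) ≈ g
  enum-index g = proj₂ (enum-surj g)

  isHalvable : Fin size → Bool
  isHalvable j = isYes (halvable? (rep (enum j)))

  K : ℕ
  K = countFin size isHalvable

  halvable : Fin K → Carrier
  halvable b = enum (select size isHalvable b)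

  halvable-rep : ∀ b → Halvable (rep (halvable b))
  halvable-rep b = toWitness {a? = halvable? (rep (halvable b))} (select-satisfies size isHalvable b)

  halvable-double-injective : ∀ {b b′} → halvable b ∙ halvable b ≈ halvable b′ ∙ halvable b′ → b ≡ b′
  halvable-double-injective {b} {b′} eq = select-injective size isHalvable (enum-inj _ _ (begin
    halvable b   ≈⟨ lin-rep _ ⟨
    lin G e S    ≈⟨ lin-cong G {e = e} {e′} S (λ i → double-injective _ _ (doubled-unique i)) ⟩
    lin G e′ S   ≈⟨ lin-rep _ ⟩
    halvable b′  ∎))
    where
    e = rep (halvable b)
    e′ = rep (halvable b′)
    doubled-rep-wt : ∀ g → wt (doubled (rep g)) ≤ 2
    doubled-rep-wt g = ℕₚ.≤-trans (ℕₚ.≤-reflexive (wt-doubled (rep g))) (rep-wt g)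
    doubled-unique : ∀ i → doubled e i ≡ doubled e′ i
    doubled-unique = unique (halvable-rep b) (doubled-rep-wt _) (halvable-rep b′) (doubled-rep-wt _) (begin
      lin G (doubled e) S        ≈⟨ lin-double G e S ⟩
      lin G e S ∙ lin G e S      ≈⟨ ∙-cong (lin-rep _) (lin-rep _) ⟩
      halvable b ∙ halvable b    ≈⟨ eq ⟩
      halvable b′ ∙ halvable b′  ≈⟨ ∙-cong (lin-rep _) (lin-rep _) ⟨
      lin G e′ S ∙ lin G e′ S    ≈⟨ lin-double G e′ S ⟨
      lin G (doubled e′) S       ∎)

  involution : Fin (suc (m₂ G F _≟_)) → Carrier
  involution zero    = ε
  involution (suc a) = enum (select size (order2? G _≟_ ∘ enum) a)

  order2?-sound : ∀ x → T (order2? G _≟_ x) → ¬ x ≈ ε × x ∙ x ≈ ε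
  order2?-sound x t with x ≟ ε | (x ∙ x) ≟ ε
  ... | no x≉ε | yes x²≈ε = x≉ε , x²≈ε

  involution-square : ∀ a → involution a ∙ involution a ≈ ε
  involution-square zero    = identityˡ ε
  involution-square (suc a) = proj₂ (order2?-sound _ (select-satisfies size _ a))

  involution-injective : ∀ {a a′} → involution a ≈ involution a′ → a ≡ a′
  involution-injective {zero}  {zero}   _  = refl
  involution-injective {zero}  {suc a′} eq = contradiction (≈-sym eq) (proj₁ (order2?-sound _ (select-satisfies size _ a′)))
  involution-injective {suc a} {zero}   eq = contradiction eq (proj₁ (order2?-sound _ (select-satisfies size _ a)))
  involution-injective {suc a} {suc a′} eq = cong suc (select-injective size _ (enum-inj _ _ eq))

  translate : Fin (suc (m₂ G F _≟_)) → Fin K → Fin size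
  translate a b = index (involution a ∙ halvable b)

  translate-injective : ∀ {a b a′ b′} → translate a b ≡ translate a′ b′ → a ≡ a′ × b ≡ b′
  translate-injective {a} {b} {a′} {b′} eq = involution-injective (∙-cancelʳ _ _ _ th≈t′h) , b≡b′
    where
    th≈t′h′ : involution a ∙ halvable b ≈ involution a′ ∙ halvable b′
    th≈t′h′ = begin
      involution a ∙ halvable b    ≈⟨ enum-index _ ⟨
      enum (translate a b)         ≡⟨ cong enum eq ⟩
      enum (translate a′ b′)       ≈⟨ enum-index _ ⟩
      involution a′ ∙ halvable b′  ∎
    b≡b′ : b ≡ b′
    b≡b′ = halvable-double-injective (begin
      halvable b ∙ halvable b                                        ≈⟨ square-∙-involution G _ (involution-square a) ⟨
      (involution a ∙ halvable b) ∙ (involution a ∙ halvable b)      ≈⟨ ∙-cong th≈t′h′ th≈t′h′ ⟩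
      (involution a′ ∙ halvable b′) ∙ (involution a′ ∙ halvable b′)  ≈⟨ square-∙-involution G _ (involution-square a′) ⟩
      halvable b′ ∙ halvable b′                                      ∎)
    th≈t′h : involution a ∙ halvable b ≈ involution a′ ∙ halvable b
    th≈t′h = ≈-trans th≈t′h′ (∙-congˡ (reflexive (cong halvable (sym b≡b′))))

  translates≤ : suc (m₂ G F _≟_) * K ≤ size
  translates≤ = injective⇒*≤ translate translate-injective

  shrunk : Carrier → Fin n → ℤ
  shrunk g i = proj₂ (encode (rep g i))

  digits : Carrier → Fin n → Fin 3
  digits g i = proj₁ (encode (rep g i))

  shrunk-halvable : ∀ g → Halvable (shrunk g)
  shrunk-halvable g i = encode-halvable k (rep g i) (rep-bounded g i)

  shrunk-wt : ∀ g → wt (shrunk g) ≤ 2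
  shrunk-wt g = ℕₚ.≤-trans (ℕₚ.≤-reflexive (wt-∘ (proj₂ ∘ encode) refl encode≡0⇒≡0 (rep g))) (rep-wt g)

  core : Carrier → Fin size
  core g = index (lin G (shrunk g) S)

  rep-core : ∀ g i → rep (enum (core g)) i ≡ shrunk g i
  rep-core g = rep-unique (halvable⇒bounded {shrunk g} (shrunk-halvable g)) (shrunk-wt g) (≈-sym (enum-index _))

  core-halvable : ∀ g → T (isHalvable (core g))
  core-halvable g = fromWitness λ i →
    subst (λ z → width (z ℤ.+ z) ≤ suc (suc k)) (sym (rep-core g i)) (shrunk-halvable g i)

  -- g is determined by shrunk g, which is the representation of core g, and its digits on the support.
  code : Fin size → Fin (4 * 4) × Fin K
  code i = uncurry combine (firstTwo (onSupport (shrunk g) (digits g))) ,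
           rank size isHalvable (core g) (core-halvable g)
    where g = enum i

  code-injective : Injective _≡_ _≡_ code
  code-injective {i} {i′} eq = enum-inj i i′ (begin
    enum i            ≈⟨ lin-rep _ ⟨
    lin G (rep g) S   ≈⟨ lin-cong G {e = rep g} {rep g′} S (λ l → encode-determined (same-shrunk l) (same-digits l)) ⟩
    lin G (rep g′) S  ≈⟨ lin-rep _ ⟩
    enum i′           ∎)
    where
    g = enum i
    g′ = enum i′
    same-core : core g ≡ core g′
    same-core = rank-injective size isHalvable _ _ (cong proj₂ eq)
    same-shrunk : ∀ l → shrunk g l ≡ shrunk g′ l
    same-shrunk l = trans (sym (rep-core g l)) (trans (cong (λ j → rep (enum j) l) same-core) (rep-core g′ l))
    length≤2 : ∀ g → length (onSupport (shrunk g) (digits g)) ≤ 2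
    length≤2 g = ℕₚ.≤-trans (ℕₚ.≤-reflexive (length-onSupport (shrunk g) (digits g))) (shrunk-wt g)
    same-digits : ∀ l → shrunk g l ≢ 0ℤ → digits g l ≡ digits g′ l
    same-digits = onSupport-injective same-shrunk (firstTwo-injective (length≤2 g) (length≤2 g′)
      (uncurry (cong₂ _,_) (Finₚ.combine-injective _ _ _ _ (cong proj₁ eq))))

  codes≤ : size ≤ 16 * K
  codes≤ = injective⇒≤* code code-injective

  m₂<16 : m₂ G F _≟_ < 16
  m₂<16 = ℕₚ.*-cancelʳ-≤ (suc (m₂ G F _≟_)) 16 K {{Finₚ.nonZeroIndex (proj₂ (code (index ε)))}}
    (ℕₚ.≤-trans translates≤ codes≤)

2^⌊log2⌋n≤n : ∀ n (rec : Acc _<_ (suc n)) → 2 ^ ⌊log2⌋ (suc n) rec ≤ suc n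
2^⌊log2⌋n≤n zero    _        = ℕₚ.≤-refl
2^⌊log2⌋n≤n (suc n) (acc rs) = begin
  2 * 2 ^ ⌊log2⌋ (suc ⌊ n /2⌋) _  ≤⟨ ℕₚ.*-monoʳ-≤ 2 (2^⌊log2⌋n≤n ⌊ n /2⌋ (rs (ℕₚ.⌊n/2⌋<n (suc n)))) ⟩
  2 * suc ⌊ n /2⌋                 ≡⟨ double-suc ⌊ n /2⌋ ⟩
  2 + (⌊ n /2⌋ + ⌊ n /2⌋)         ≤⟨ ℕₚ.+-monoʳ-≤ 2 (ℕₚ.+-monoʳ-≤ ⌊ n /2⌋ (ℕₚ.⌊n/2⌋≤⌈n/2⌉ n)) ⟩
  2 + (⌊ n /2⌋ + ⌈ n /2⌉)         ≡⟨ cong (λ h → 2 + h) (ℕₚ.⌊n/2⌋+⌈n/2⌉≡n n) ⟩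
  2 + n                           ∎
  where
  open ℕₚ.≤-Reasoning
  double-suc : ∀ h → 2 * suc h ≡ 2 + (h + h)
  double-suc = solve-∀

2^⌊log₂n⌋≤n : ∀ n → 2 ^ ⌊log₂ suc n ⌋ ≤ suc n
2^⌊log₂n⌋≤n n = 2^⌊log2⌋n≤n n (<-wellFounded (suc n))

bound-arithmetic : ∀ x n s k → x < 16 → 1 ≤ n → 2 ^ k ≤ s →
                   (x + 1) ^ (s + 1) * 2 ^ (2 ^ (k + 1)) ≤ n ^ 2 * 2 ^ ((s + 1) * (k + 5) + s)
bound-arithmetic x n s k x<16 1≤n 2^k≤s = begin
  (x + 1) ^ (s + 1) * 2 ^ (2 ^ (k + 1))  ≤⟨ ℕₚ.*-mono-≤ (ℕₚ.^-monoˡ-≤ (s + 1) x+1≤16) (ℕₚ.^-monoʳ-≤ 2 2^[k+1]≤2s) ⟩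
  16 ^ (s + 1) * 2 ^ (2 * s)             ≡⟨ cong (_* 2 ^ (2 * s)) (ℕₚ.^-*-assoc 2 4 (s + 1)) ⟩
  2 ^ (4 * (s + 1)) * 2 ^ (2 * s)        ≡⟨ ℕₚ.^-distribˡ-+-* 2 (4 * (s + 1)) (2 * s) ⟨
  2 ^ (4 * (s + 1) + 2 * s)              ≤⟨ ℕₚ.^-monoʳ-≤ 2 exponents ⟩
  2 ^ ((s + 1) * (k + 5) + s)            ≡⟨ ℕₚ.*-identityˡ _ ⟨
  1 * 2 ^ ((s + 1) * (k + 5) + s)        ≤⟨ ℕₚ.*-monoˡ-≤ (2 ^ ((s + 1) * (k + 5) + s)) (ℕₚ.^-monoˡ-≤ 2 1≤n) ⟩
  n ^ 2 * 2 ^ ((s + 1) * (k + 5) + s)    ∎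
  where
  open ℕₚ.≤-Reasoning
  x+1≤16 : x + 1 ≤ 16
  x+1≤16 = ℕₚ.≤-trans (ℕₚ.≤-reflexive (ℕₚ.+-comm x 1)) x<16
  2^[k+1]≤2s : 2 ^ (k + 1) ≤ 2 * s
  2^[k+1]≤2s = ℕₚ.≤-trans (ℕₚ.≤-reflexive (cong (2 ^_) (ℕₚ.+-comm k 1))) (ℕₚ.*-monoʳ-≤ 2 2^k≤s)
  exponents-gap : ∀ s k → 4 * (s + 1) + 2 * s + ((s + 1) * k + 1) ≡ (s + 1) * (k + 5) + s
  exponents-gap = solve-∀
  exponents : 4 * (s + 1) + 2 * s ≤ (s + 1) * (k + 5) + s
  exponents = ℕₚ.≤-trans (ℕₚ.m≤m+n _ ((s + 1) * k + 1)) (ℕₚ.≤-reflexive (exponents-gap s k))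

lemma9 : {c ℓ : Level} (G : AbelianGroup c ℓ) (F : FiniteEnum G)
    (_≟_ : ∀ x y → Dec (AbelianGroup._≈_ G x y))
    (m n : ℕ) → 2 ≤ m → 1 ≤ n →
    (S : Fin n → AbelianGroup.Carrier G) →
    Perfect G (Interval* (- (+ m) Data.Integer.+ + 1) (+ m)) 2 S →
    let s = ⌊log₂ m ⌋
        k = ⌊log₂ s ⌋
    in (m₂ G F _≟_ + 1) ^ (s + 1) * 2 ^ (2 ^ (k + 1))
         ≤ n ^ 2 * 2 ^ ((s + 1) * (k + 5) + s)
lemma9 G F _≟_ (suc (suc j)) n (s≤s (s≤s _)) 1≤n S perfect =
  bound-arithmetic (m₂ G F _≟_) n s ⌊log₂ s ⌋ (PerfectCode.m₂<16 G F _≟_ j n S perfect) 1≤n (2^⌊log₂n⌋≤n _)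
  where s = ⌊log₂ suc (suc j) ⌋
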